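{- Let $\mathbb{K}$ be a field of characteristic zero, $n\ge1$, and $M\in M_n(\mathbb{K})$ any square matrix. Then $\Delta(M)=\mathcal{D}(M)$.
   Context: Let $M=(M_{ij})$ with $i$-th row $M_i$. For $i\in[n]$ define the finite difference $\Delta_i(p(\mathbf{x}))=p(\mathbf{x}-M_i)-p(\mathbf{x})$ on $\mathbb{K}[x_1,\dots,x_n]$, where $\mathbf{x}-M_i=(x_1-M_{i1},\dots,x_n-M_{in})$, and the directional derivative $\mathcal{D}_i=\sum_{j=1}^n M_{ij}\frac{\partial}{\partial x_j}$. Define $\Delta(M)=\bigcap_{i=1}^n\{p : \frac{\partial}{\partial x_i}\Delta_i(p)=0\}$ and $\mathcal{D}(M)=\bigcap_{i=1}^n\{p : \frac{\partial}{\partial x_i}\mathcal{D}_i(p)=0\}$. -}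

module Defs where

open import Level using (Level; _⊔_; Lift) renaming (suc to lsuc)
open import Algebra.Bundles using (CommutativeRing)
open import Data.Nat using (ℕ; zero; suc)
open import Data.Fin using (Fin; zero; suc)
open import Data.List using (List; []; _∷_)
open import Data.List.Relation.Unary.All using (All)
open import Data.Product using (∃; _×_)
open import Function using (_∘_)
open import Relation.Nullary using (¬_)

record Field (c ℓ : Level) : Set (lsuc (c ⊔ ℓ)) where
  field
    commutativeRing : CommutativeRing c ℓ
  open CommutativeRing commutativeRing public
    using (Carrier; _≈_; 0#; 1#; _+_; _*_; -_)
  field
    0≉1     : ¬ (0# ≈ 1#)
    inverse : ∀ x → ¬ (x ≈ 0#) → ∃ λ y → (x * y) ≈ 1#

module _ {c ℓ} (R : CommutativeRing c ℓ) where
  open CommutativeRing R using (Carrier; 0#; 1#; _+_)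
  natCast : ℕ → Carrier
  natCast zero    = 0#
  natCast (suc k) = 1# + natCast k

CharZero : ∀ {c ℓ} → Field c ℓ → Set ℓ
CharZero F = ∀ k → ¬ (natCast (Field.commutativeRing F) (suc k) ≈ 0#)
  where open Field F

-- Polynomial ring K[x_1,...,x_n] (variables indexed by Fin n), dense recursive
-- representation: Poly (suc n) = polynomials in the first variable with
-- coefficients in Poly n (the polynomial ring in the remaining variables),
-- given as the list of coefficients of x^0, x^1, x^2, ...
module PolyOver {c ℓ} (R : CommutativeRing c ℓ) where
  open CommutativeRing R using (_≈_; 0#; 1#; _+_; _*_; -_) renaming (Carrier to K)

  data Poly : ℕ → Set c where
    con  : K → Poly zero
    poly : ∀ {n} → List (Poly n) → Poly (suc n)

  0P : ∀ {n} → Poly n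
  0P {zero}  = con 0#
  0P {suc n} = poly []

  cst : ∀ {n} → K → Poly n
  cst {zero}  a = con a
  cst {suc n} a = poly (cst a ∷ [])

  infixl 6 _+P_
  infixl 7 _*P_

  _+P_ : ∀ {n} → Poly n → Poly n → Poly n
  addL : ∀ {n} → List (Poly n) → List (Poly n) → List (Poly n)
  con a  +P con b  = con (a + b)
  poly p +P poly q = poly (addL p q)
  addL []       ys       = ys
  addL (x ∷ xs) []       = x ∷ xs
  addL (x ∷ xs) (y ∷ ys) = (x +P y) ∷ addL xs ys

  -P_ : ∀ {n} → Poly n → Poly n
  negL : ∀ {n} → List (Poly n) → List (Poly n)
  -P con a  = con (- a)
  -P poly p = poly (negL p)
  negL []       = []
  negL (x ∷ xs) = (-P x) ∷ negL xs

  scaleL : ∀ {n} → Poly n → List (Poly n) → List (Poly n)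
  _*P_ : ∀ {n} → Poly n → Poly n → Poly n
  mulL : ∀ {n} → List (Poly n) → List (Poly n) → List (Poly n)
  scaleL a []       = []
  scaleL a (y ∷ ys) = (a *P y) ∷ scaleL a ys
  con a  *P con b  = con (a * b)
  poly p *P poly q = poly (mulL p q)
  mulL []       ys = []
  mulL (x ∷ xs) ys = addL (scaleL x ys) (0P ∷ mulL xs ys)

  -- equality of polynomials: coefficientwise, up to trailing zero coefficients
  IsZero : ∀ {n} → Poly n → Set (c ⊔ ℓ)
  IsZero (con a)  = Lift c (a ≈ 0#)
  IsZero (poly p) = All IsZero p

  infix 4 _≈P_
  _≈P_ : ∀ {n} → Poly n → Poly n → Set (c ⊔ ℓ)
  eqL : ∀ {n} → List (Poly n) → List (Poly n) → Set (c ⊔ ℓ)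
  con a  ≈P con b  = Lift c (a ≈ b)
  poly p ≈P poly q = eqL p q
  eqL []       ys       = All IsZero ys
  eqL (x ∷ xs) []       = All IsZero (x ∷ xs)
  eqL (x ∷ xs) (y ∷ ys) = (x ≈P y) × eqL xs ys

  ∂ : ∀ {n} → Fin n → Poly n → Poly n
  derivL : ∀ {n} → ℕ → List (Poly n) → List (Poly n)
  mapL∂ : ∀ {n} → Fin n → List (Poly n) → List (Poly n)
  ∂ zero    (poly [])       = poly []
  ∂ zero    (poly (a ∷ as)) = poly (derivL 1 as)
  ∂ (suc j) (poly p)        = poly (mapL∂ j p)
  derivL k []       = []
  derivL k (b ∷ bs) = (cst (natCast R k) *P b) ∷ derivL (suc k) bs
  mapL∂ j []       = []
  mapL∂ j (a ∷ as) = ∂ j a ∷ mapL∂ j as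

  -- shift p(x) ↦ p(x - v), i.e. substitute x_j ↦ x_j - v_j for every j
  shift : ∀ {n} → (Fin n → K) → Poly n → Poly n
  shiftL : ∀ {n} → (Fin (suc n) → K) → List (Poly n) → List (Poly n)
  shift v (con a)  = con a
  shift v (poly p) = poly (shiftL v p)
  -- Horner scheme: a_0 + (x_0 - v_0) * (a_1 + (x_0 - v_0) * (...))
  shiftL v []       = []
  shiftL v (a ∷ as) =
    addL (shift (v ∘ suc) a ∷ []) (mulL (cst (- v zero) ∷ cst 1# ∷ []) (shiftL v as))

  sumP : ∀ {n m} → (Fin m → Poly n) → Poly n
  sumP {m = zero}  f = 0P
  sumP {m = suc m} f = f zero +P sumP (f ∘ suc)

  module _ {n : ℕ} (M : Fin n → Fin n → K) where
    Δ : Fin n → Poly n → Poly n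
    Δ i p = shift (M i) p +P (-P p)

    D : Fin n → Poly n → Poly n
    D i p = sumP (λ j → cst (M i j) *P ∂ j p)

    InΔ : Poly n → Set (c ⊔ ℓ)
    InΔ p = ∀ i → ∂ i (Δ i p) ≈P 0P

    InD : Poly n → Set (c ⊔ ℓ)
    InD p = ∀ i → ∂ i (D i p) ≈P 0P

-- Write v = M_i. By Taylor's formula, translation by v acts on polynomials as
-- exp(-∂[v]) = Σₖ (-1)ᵏ/k! ∂[v]ᵏ, a finite sum because ∂[v] lowers the degree
-- (dividing by k! is where characteristic zero is used). In particular translation
-- commutes with ∂_i, so ∂_i Δ_i p = Δ_i w for w = ∂_i p, and the expansion reads
-- Δ_i w = -u + ∂[v] (T u), where u = ∂[v] w = ∂_i D_i p and T preserves degree bounds.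
-- Hence u = 0 gives Δ_i w = 0; conversely Δ_i w = 0 gives u = ∂[v] (T u), which
-- forces u = 0 because ∂[v] strictly lowers the degree.
module Submission where

open import Level using (_⊔_; Lift; lift)
open import Data.Unit.Polymorphic using (⊤; tt)
open import Algebra.Bundles using (CommutativeRing; AbelianGroup)
open import Algebra.Structures using (IsAbelianGroup)
import Algebra.Properties.AbelianGroup as AbelianGroupProperties
import Algebra.Properties.CommutativeSemigroup as CommutativeSemigroupProperties
import Algebra.Properties.Ring as RingProperties
open import Data.Nat using (ℕ; zero; suc; _≤_; z≤n; _∸_)
import Data.Nat as ℕ
import Data.Nat.Properties as ℕ
open import Data.Fin using (Fin; zero; suc; toℕ)
open import Data.List using (List; []; _∷_)
open import Data.List.Relation.Unary.All using (All; []; _∷_)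
open import Data.Product using (∃; _×_; _,_; proj₁; proj₂)
open import Function using (_∘_; _⇔_; mk⇔; Equivalence)
open Equivalence using (to; from)
import Function.Endo.Propositional
import Function.Properties.Equivalence as ⇔
open import Relation.Binary.Bundles using (Setoid)
open import Relation.Binary.PropositionalEquality using (_≡_)
import Relation.Binary.PropositionalEquality as ≡
import Relation.Binary.Reasoning.Setoid as SetoidReasoning
open import Defs

module Scalars {c ℓ} (R : CommutativeRing c ℓ) where
  open CommutativeRing R renaming (Carrier to K)
  open RingProperties ring using (-‿distribˡ-*; -‿distribʳ-*)
  open SetoidReasoning setoid

  ι : ℕ → K
  ι = natCast R

  ι1≈1 : ι 1 ≈ 1#
  ι1≈1 = +-identityʳ 1#

  module TaylorCoefficients (1/[1+_] : ℕ → K) (*-inverse : ∀ k → ι (suc k) * 1/[1+ k ] ≈ 1#) where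

    -- taylorCoeff k = (-1)ᵏ / k!, the coefficient of ∂[ v ]ᵏ p in p(x - v).
    taylorCoeff : ℕ → K
    taylorCoeff zero    = 1#
    taylorCoeff (suc k) = - (1/[1+ k ] * taylorCoeff k)

    taylorCoeff-1 : taylorCoeff 1 ≈ - 1#
    taylorCoeff-1 = -‿cong (begin
      1/[1+ 0 ] * 1#      ≈⟨ *-identityʳ _ ⟩
      1/[1+ 0 ]           ≈⟨ *-identityˡ _ ⟨
      1# * 1/[1+ 0 ]      ≈⟨ *-cong ι1≈1 refl ⟨
      ι 1 * 1/[1+ 0 ]     ≈⟨ *-inverse 0 ⟩
      1#                  ∎)

    taylorCoeff-suc : ∀ k α → taylorCoeff (suc k) * (ι (suc k) * α) ≈ (- α) * taylorCoeff k
    taylorCoeff-suc k α = begin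
      t′ * (m * α)                  ≈⟨ *-assoc t′ m α ⟨
      t′ * m * α                    ≈⟨ *-cong (*-comm t′ m) refl ⟩
      m * - (1/[1+ k ] * t) * α     ≈⟨ *-cong (-‿distribʳ-* m _) refl ⟨
      - (m * (1/[1+ k ] * t)) * α   ≈⟨ *-cong (-‿cong (*-assoc m _ t)) refl ⟨
      - (m * 1/[1+ k ] * t) * α     ≈⟨ *-cong (-‿cong (trans (*-cong (*-inverse k) refl) (*-identityˡ t))) refl ⟩
      - t * α                       ≈⟨ -‿distribˡ-* t α ⟨
      - (t * α)                     ≈⟨ -‿cong (*-comm t α) ⟩
      - (α * t)                     ≈⟨ -‿distribˡ-* α t ⟩
      (- α) * t                     ∎
      where
      t  = taylorCoeff k
      t′ = taylorCoeff (suc k)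
      m  = ι (suc k)

module Polynomials {c ℓ} (R : CommutativeRing c ℓ) where
  open CommutativeRing R renaming (Carrier to K) hiding (zero)
  open RingProperties ring using (-0#≈0#; -1*x≈-x)
  open PolyOver R public
  open Scalars R public

  -- Coefficientwise equality

  -- A record, so that p and q can be inferred from a proof of p ≋ q (p ≈P q computes).
  infix 4 _≋_
  record _≋_ {n} (p q : Poly n) : Set (c ⊔ ℓ) where
    constructor wrap
    field unwrap : p ≈P q
  open _≋_ public

  coeffL : ∀ {n} → List (Poly n) → ℕ → Poly n
  coeffL []       k       = 0P
  coeffL (a ∷ as) zero    = a
  coeffL (a ∷ as) (suc k) = coeffL as k

  coeff : ∀ {n} → Poly (suc n) → ℕ → Poly n
  coeff (poly as) = coeffL as

  ≈P-refl : ∀ {n} (p : Poly n) → p ≈P p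
  eqL-refl : ∀ {n} (as : List (Poly n)) → eqL as as
  ≈P-refl (con a)   = lift refl
  ≈P-refl (poly as) = eqL-refl as
  eqL-refl []       = []
  eqL-refl (a ∷ as) = ≈P-refl a , eqL-refl as

  ≋-refl : ∀ {n} {p : Poly n} → p ≋ p
  ≋-refl {p = p} = wrap (≈P-refl p)

  IsZero⇒≋0P : ∀ {n} {p : Poly n} → IsZero p → p ≋ 0P
  IsZero⇒≋0P {p = con a}         z = wrap z
  IsZero⇒≋0P {p = poly []}       z = wrap []
  IsZero⇒≋0P {p = poly (a ∷ as)} z = wrap z

  ≋0P⇒IsZero : ∀ {n} {p : Poly n} → p ≋ 0P → IsZero p
  ≋0P⇒IsZero {p = con a}         (wrap z) = z
  ≋0P⇒IsZero {p = poly []}       _        = []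
  ≋0P⇒IsZero {p = poly (a ∷ as)} (wrap z) = z

  IsZero⇒0P≋ : ∀ {n} {p : Poly n} → IsZero p → 0P ≋ p
  IsZero⇒0P≋ {p = con a}   (lift z) = wrap (lift (sym z))
  IsZero⇒0P≋ {p = poly as} z        = wrap z

  0P≋⇒IsZero : ∀ {n} {p : Poly n} → 0P ≋ p → IsZero p
  0P≋⇒IsZero {p = con a}   (wrap (lift z)) = lift (sym z)
  0P≋⇒IsZero {p = poly as} (wrap z)        = z

  All-IsZero⇒eqL[] : ∀ {n} {as : List (Poly n)} → All IsZero as → eqL as []
  All-IsZero⇒eqL[] []       = []
  All-IsZero⇒eqL[] (z ∷ zs) = z ∷ zs

  eqL[]⇒All-IsZero : ∀ {n} {as : List (Poly n)} → eqL as [] → All IsZero as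
  eqL[]⇒All-IsZero {as = []}    _ = []
  eqL[]⇒All-IsZero {as = _ ∷ _} e = e

  eqL⇒coeffL≋ : ∀ {n} {as bs : List (Poly n)} → eqL as bs → ∀ k → coeffL as k ≋ coeffL bs k
  eqL⇒coeffL≋ {as = []}     {[]}     _          k       = ≋-refl
  eqL⇒coeffL≋ {as = []}     {b ∷ bs} (z ∷ _)    zero    = IsZero⇒0P≋ z
  eqL⇒coeffL≋ {as = []}     {b ∷ bs} (_ ∷ zs)   (suc k) = eqL⇒coeffL≋ {as = []} zs k
  eqL⇒coeffL≋ {as = a ∷ as} {[]}     (z ∷ _)    zero    = IsZero⇒≋0P z
  eqL⇒coeffL≋ {as = a ∷ as} {[]}     (_ ∷ zs)   (suc k) = eqL⇒coeffL≋ (All-IsZero⇒eqL[] zs) k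
  eqL⇒coeffL≋ {as = a ∷ as} {b ∷ bs} (e , _)    zero    = wrap e
  eqL⇒coeffL≋ {as = a ∷ as} {b ∷ bs} (_ , es)   (suc k) = eqL⇒coeffL≋ es k

  coeffL≋⇒eqL : ∀ {n} (as bs : List (Poly n)) → (∀ k → coeffL as k ≋ coeffL bs k) → eqL as bs
  coeffL≋⇒eqL []       []       _ = []
  coeffL≋⇒eqL []       (b ∷ bs) e = 0P≋⇒IsZero (e 0) ∷ coeffL≋⇒eqL [] bs (e ∘ suc)
  coeffL≋⇒eqL (a ∷ as) []       e = ≋0P⇒IsZero (e 0) ∷ eqL[]⇒All-IsZero (coeffL≋⇒eqL as [] (e ∘ suc))
  coeffL≋⇒eqL (a ∷ as) (b ∷ bs) e = unwrap (e 0) , coeffL≋⇒eqL as bs (e ∘ suc)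

  coeff-cong : ∀ {n} {p q : Poly (suc n)} → p ≋ q → ∀ k → coeff p k ≋ coeff q k
  coeff-cong {p = poly as} {poly bs} (wrap e) = eqL⇒coeffL≋ e

  coeff-ext : ∀ {n} {p q : Poly (suc n)} → (∀ k → coeff p k ≋ coeff q k) → p ≋ q
  coeff-ext {p = poly as} {poly bs} e = wrap (coeffL≋⇒eqL as bs e)

  ≋-sym : ∀ {n} {p q : Poly n} → p ≋ q → q ≋ p
  ≋-sym {zero}  {con a} {con b} (wrap (lift e)) = wrap (lift (sym e))
  ≋-sym {suc n} e = coeff-ext (λ k → ≋-sym (coeff-cong e k))

  ≋-trans : ∀ {n} {p q r : Poly n} → p ≋ q → q ≋ r → p ≋ r
  ≋-trans {zero}  {con a} {con b} {con d} (wrap (lift e)) (wrap (lift e′)) = wrap (lift (trans e e′))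
  ≋-trans {suc n} e e′ = coeff-ext (λ k → ≋-trans (coeff-cong e k) (coeff-cong e′ k))

  ≋-setoid : ℕ → Setoid c (c ⊔ ℓ)
  ≋-setoid n = record
    { Carrier       = Poly n
    ; _≈_           = _≋_
    ; isEquivalence = record { refl = ≋-refl ; sym = ≋-sym ; trans = ≋-trans }
    }

  ≋⇒≋0P⇔≋0P : ∀ {n} {p q : Poly n} → p ≋ q → p ≋ 0P ⇔ q ≋ 0P
  ≋⇒≋0P⇔≋0P p≋q = mk⇔ (≋-trans (≋-sym p≋q)) (≋-trans p≋q)

  open module ≋-Setoid {n} = Setoid (≋-setoid n) using () renaming (reflexive to ≋-reflexive)
  open module ≋-Reasoning {n} = SetoidReasoning (≋-setoid n)
  open module Endo {n} = Function.Endo.Propositional (Poly n) using (_^_; ^-homo)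

  -- Additive structure

  +P-identityˡ : ∀ {n} (p : Poly n) → 0P +P p ≋ p
  +P-identityˡ (con a)   = wrap (lift (+-identityˡ a))
  +P-identityˡ (poly as) = ≋-refl

  +P-identityʳ : ∀ {n} (p : Poly n) → p +P 0P ≋ p
  +P-identityʳ (con a)         = wrap (lift (+-identityʳ a))
  +P-identityʳ (poly [])       = ≋-refl
  +P-identityʳ (poly (a ∷ as)) = ≋-refl

  coeffL-addL : ∀ {n} (as bs : List (Poly n)) k → coeffL (addL as bs) k ≋ coeffL as k +P coeffL bs k
  coeffL-addL []       bs       k       = ≋-sym (+P-identityˡ _)
  coeffL-addL (a ∷ as) []       k       = ≋-sym (+P-identityʳ _)
  coeffL-addL (a ∷ as) (b ∷ bs) zero    = ≋-refl
  coeffL-addL (a ∷ as) (b ∷ bs) (suc k) = coeffL-addL as bs k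

  coeff-+P : ∀ {n} (p q : Poly (suc n)) k → coeff (p +P q) k ≋ coeff p k +P coeff q k
  coeff-+P (poly as) (poly bs) = coeffL-addL as bs

  -P-0P : ∀ {n} → -P 0P ≋ 0P {n}
  -P-0P {zero}  = wrap (lift -0#≈0#)
  -P-0P {suc n} = ≋-refl

  coeffL-negL : ∀ {n} (as : List (Poly n)) k → coeffL (negL as) k ≋ -P coeffL as k
  coeffL-negL []       k       = ≋-sym -P-0P
  coeffL-negL (a ∷ as) zero    = ≋-refl
  coeffL-negL (a ∷ as) (suc k) = coeffL-negL as k

  coeff-negP : ∀ {n} (p : Poly (suc n)) k → coeff (-P p) k ≋ -P coeff p k
  coeff-negP (poly as) = coeffL-negL as

  +P-cong : ∀ {n} {p p′ q q′ : Poly n} → p ≋ p′ → q ≋ q′ → p +P q ≋ p′ +P q′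
  +P-cong {zero} {con _} {con _} {con _} {con _} (wrap (lift e)) (wrap (lift e′)) = wrap (lift (+-cong e e′))
  +P-cong {suc n} {p} {p′} {q} {q′} e e′ = coeff-ext λ k → begin
    coeff (p +P q) k         ≈⟨ coeff-+P p q k ⟩
    coeff p k +P coeff q k   ≈⟨ +P-cong (coeff-cong e k) (coeff-cong e′ k) ⟩
    coeff p′ k +P coeff q′ k ≈⟨ coeff-+P p′ q′ k ⟨
    coeff (p′ +P q′) k       ∎

  +P-comm : ∀ {n} (p q : Poly n) → p +P q ≋ q +P p
  +P-comm (con a) (con b) = wrap (lift (+-comm a b))
  +P-comm {suc n} p q = coeff-ext λ k → begin
    coeff (p +P q) k       ≈⟨ coeff-+P p q k ⟩
    coeff p k +P coeff q k ≈⟨ +P-comm (coeff p k) (coeff q k) ⟩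
    coeff q k +P coeff p k ≈⟨ coeff-+P q p k ⟨
    coeff (q +P p) k       ∎

  +P-assoc : ∀ {n} (p q r : Poly n) → (p +P q) +P r ≋ p +P (q +P r)
  +P-assoc (con a) (con b) (con d) = wrap (lift (+-assoc a b d))
  +P-assoc {suc n} p q r = coeff-ext λ k → begin
    coeff ((p +P q) +P r) k              ≈⟨ coeff-+P (p +P q) r k ⟩
    coeff (p +P q) k +P coeff r k        ≈⟨ +P-cong (coeff-+P p q k) ≋-refl ⟩
    (coeff p k +P coeff q k) +P coeff r k ≈⟨ +P-assoc (coeff p k) (coeff q k) (coeff r k) ⟩
    coeff p k +P (coeff q k +P coeff r k) ≈⟨ +P-cong ≋-refl (coeff-+P q r k) ⟨
    coeff p k +P coeff (q +P r) k        ≈⟨ coeff-+P p (q +P r) k ⟨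
    coeff (p +P (q +P r)) k              ∎

  -P-cong : ∀ {n} {p q : Poly n} → p ≋ q → -P p ≋ -P q
  -P-cong {zero} {con _} {con _} (wrap (lift e)) = wrap (lift (-‿cong e))
  -P-cong {suc n} {p} {q} e = coeff-ext λ k → begin
    coeff (-P p) k ≈⟨ coeff-negP p k ⟩
    -P coeff p k   ≈⟨ -P-cong (coeff-cong e k) ⟩
    -P coeff q k   ≈⟨ coeff-negP q k ⟨
    coeff (-P q) k ∎

  +P-inverseʳ : ∀ {n} (p : Poly n) → p +P -P p ≋ 0P
  +P-inverseʳ (con a) = wrap (lift (-‿inverseʳ a))
  +P-inverseʳ {suc n} p = coeff-ext λ k → begin
    coeff (p +P -P p) k       ≈⟨ coeff-+P p (-P p) k ⟩
    coeff p k +P coeff (-P p) k ≈⟨ +P-cong ≋-refl (coeff-negP p k) ⟩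
    coeff p k +P -P coeff p k ≈⟨ +P-inverseʳ (coeff p k) ⟩
    0P                        ∎

  +P-isAbelianGroup : ∀ n → IsAbelianGroup (_≋_ {n}) _+P_ 0P -P_
  +P-isAbelianGroup n = record
    { isGroup = record
      { isMonoid = record
        { isSemigroup = record
          { isMagma = record { isEquivalence = Setoid.isEquivalence (≋-setoid n) ; ∙-cong = +P-cong }
          ; assoc   = +P-assoc
          }
        ; identity = +P-identityˡ , +P-identityʳ
        }
      ; inverse = (λ p → ≋-trans (+P-comm (-P p) p) (+P-inverseʳ p)) , +P-inverseʳ
      ; ⁻¹-cong = -P-cong
      }
    ; comm = +P-comm
    }

  +P-abelianGroup : ℕ → AbelianGroup c (c ⊔ ℓ)
  +P-abelianGroup n = record { isAbelianGroup = +P-isAbelianGroup n }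

  open module +P-Properties {n} = AbelianGroupProperties (+P-abelianGroup n)
    using (inverseʳ-unique; ⁻¹-involutive; xyx⁻¹≈y)
  open module +P-CommutativeSemigroupProperties {n} =
    CommutativeSemigroupProperties (AbelianGroup.commutativeSemigroup (+P-abelianGroup n))
    using (interchange)

  infixr 7 _·_
  _·_ : ∀ {n} → K → Poly n → Poly n
  ·L : ∀ {n} → K → List (Poly n) → List (Poly n)
  a · con b   = con (a * b)
  a · poly bs = poly (·L a bs)
  ·L a []       = []
  ·L a (b ∷ bs) = a · b ∷ ·L a bs

  ·-0P : ∀ {n} a → a · 0P ≋ 0P {n}
  ·-0P {zero}  a = wrap (lift (zeroʳ a))
  ·-0P {suc n} a = ≋-refl

  coeffL-·L : ∀ {n} a (bs : List (Poly n)) k → coeffL (·L a bs) k ≋ a · coeffL bs k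
  coeffL-·L a []       k       = ≋-sym (·-0P a)
  coeffL-·L a (b ∷ bs) zero    = ≋-refl
  coeffL-·L a (b ∷ bs) (suc k) = coeffL-·L a bs k

  coeff-· : ∀ {n} a (p : Poly (suc n)) k → coeff (a · p) k ≋ a · coeff p k
  coeff-· a (poly bs) = coeffL-·L a bs

  ·-cong : ∀ {n} {a b} {p q : Poly n} → a ≈ b → p ≋ q → a · p ≋ b · q
  ·-cong {zero} {p = con _} {con _} e (wrap (lift e′)) = wrap (lift (*-cong e e′))
  ·-cong {suc n} {a} {b} {p} {q} e e′ = coeff-ext λ k → begin
    coeff (a · p) k ≈⟨ coeff-· a p k ⟩
    a · coeff p k   ≈⟨ ·-cong e (coeff-cong e′ k) ⟩
    b · coeff q k   ≈⟨ coeff-· b q k ⟨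
    coeff (b · q) k ∎

  ·-congˡ : ∀ {n} {a} {p q : Poly n} → p ≋ q → a · p ≋ a · q
  ·-congˡ = ·-cong refl

  ·-distribˡ : ∀ {n} a (p q : Poly n) → a · (p +P q) ≋ a · p +P a · q
  ·-distribˡ a (con x) (con y) = wrap (lift (distribˡ a x y))
  ·-distribˡ {suc n} a p q = coeff-ext λ k → begin
    coeff (a · (p +P q)) k            ≈⟨ coeff-· a (p +P q) k ⟩
    a · coeff (p +P q) k              ≈⟨ ·-congˡ (coeff-+P p q k) ⟩
    a · (coeff p k +P coeff q k)      ≈⟨ ·-distribˡ a (coeff p k) (coeff q k) ⟩
    a · coeff p k +P a · coeff q k    ≈⟨ +P-cong (coeff-· a p k) (coeff-· a q k) ⟨
    coeff (a · p) k +P coeff (a · q) k ≈⟨ coeff-+P (a · p) (a · q) k ⟨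
    coeff (a · p +P a · q) k          ∎

  ·-distribʳ : ∀ {n} a b (p : Poly n) → (a + b) · p ≋ a · p +P b · p
  ·-distribʳ a b (con x) = wrap (lift (distribʳ x a b))
  ·-distribʳ {suc n} a b p = coeff-ext λ k → begin
    coeff ((a + b) · p) k              ≈⟨ coeff-· (a + b) p k ⟩
    (a + b) · coeff p k                ≈⟨ ·-distribʳ a b (coeff p k) ⟩
    a · coeff p k +P b · coeff p k     ≈⟨ +P-cong (coeff-· a p k) (coeff-· b p k) ⟨
    coeff (a · p) k +P coeff (b · p) k ≈⟨ coeff-+P (a · p) (b · p) k ⟨
    coeff (a · p +P b · p) k           ∎

  ·-assoc : ∀ {n} a b (p : Poly n) → a · b · p ≋ (a * b) · p
  ·-assoc a b (con x) = wrap (lift (sym (*-assoc a b x)))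
  ·-assoc {suc n} a b p = coeff-ext λ k → begin
    coeff (a · b · p) k   ≈⟨ coeff-· a (b · p) k ⟩
    a · coeff (b · p) k   ≈⟨ ·-congˡ (coeff-· b p k) ⟩
    a · b · coeff p k     ≈⟨ ·-assoc a b (coeff p k) ⟩
    (a * b) · coeff p k   ≈⟨ coeff-· (a * b) p k ⟨
    coeff ((a * b) · p) k ∎

  ·-identityˡ : ∀ {n} (p : Poly n) → 1# · p ≋ p
  ·-identityˡ (con x) = wrap (lift (*-identityˡ x))
  ·-identityˡ {suc n} p = coeff-ext λ k → ≋-trans (coeff-· 1# p k) (·-identityˡ (coeff p k))

  -1·p≋-Pp : ∀ {n} (p : Poly n) → (- 1#) · p ≋ -P p
  -1·p≋-Pp (con x) = wrap (lift (-1*x≈-x x))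
  -1·p≋-Pp {suc n} p = coeff-ext λ k → begin
    coeff ((- 1#) · p) k ≈⟨ coeff-· (- 1#) p k ⟩
    (- 1#) · coeff p k   ≈⟨ -1·p≋-Pp (coeff p k) ⟩
    -P coeff p k         ≈⟨ coeff-negP p k ⟨
    coeff (-P p) k       ∎

  ·-comm : ∀ {n} a b (p : Poly n) → a · b · p ≋ b · a · p
  ·-comm a b p = begin
    a · b · p   ≈⟨ ·-assoc a b p ⟩
    (a * b) · p ≈⟨ ·-cong (*-comm a b) ≋-refl ⟩
    (b * a) · p ≈⟨ ·-assoc b a p ⟨
    b · a · p   ∎

  coeffL-[0P] : ∀ {n} k → coeffL (0P {n} ∷ []) k ≋ 0P
  coeffL-[0P] zero    = ≋-refl
  coeffL-[0P] (suc k) = ≋-refl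

  coeffL-scaleL-cst : ∀ {n} a (bs : List (Poly n)) k → coeffL (scaleL (cst a) bs) k ≋ a · coeffL bs k
  cst*P≋· : ∀ {n} a (p : Poly n) → cst a *P p ≋ a · p
  cst*P≋· {zero}  a (con b)   = ≋-refl
  cst*P≋· {suc n} a (poly bs) = coeff-ext λ k → begin
    coeffL (addL (scaleL (cst a) bs) (0P ∷ [])) k      ≈⟨ coeffL-addL (scaleL (cst a) bs) (0P ∷ []) k ⟩
    coeffL (scaleL (cst a) bs) k +P coeffL (0P ∷ []) k ≈⟨ +P-cong (coeffL-scaleL-cst a bs k) (coeffL-[0P] k) ⟩
    a · coeffL bs k +P 0P                              ≈⟨ +P-identityʳ _ ⟩
    a · coeffL bs k                                    ≈⟨ coeffL-·L a bs k ⟨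
    coeffL (·L a bs) k                                 ∎
  coeffL-scaleL-cst a []       k       = ≋-sym (·-0P a)
  coeffL-scaleL-cst a (b ∷ bs) zero    = cst*P≋· a b
  coeffL-scaleL-cst a (b ∷ bs) (suc k) = coeffL-scaleL-cst a bs k

  -- Partial and directional derivatives

  ∂-0P : ∀ {n} (j : Fin n) → ∂ j 0P ≋ 0P
  ∂-0P zero    = ≋-refl
  ∂-0P (suc j) = ≋-refl

  coeffL-derivL : ∀ {n} m (bs : List (Poly n)) k → coeffL (derivL m bs) k ≋ ι (m ℕ.+ k) · coeffL bs k
  coeffL-derivL m []       k       = ≋-sym (·-0P _)
  coeffL-derivL m (b ∷ bs) zero    =
    ≋-trans (cst*P≋· (ι m) b) (·-cong (reflexive (≡.cong ι (≡.sym (ℕ.+-identityʳ m)))) ≋-refl)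
  coeffL-derivL m (b ∷ bs) (suc k) =
    ≋-trans (coeffL-derivL (suc m) bs k) (·-cong (reflexive (≡.cong ι (≡.sym (ℕ.+-suc m k)))) ≋-refl)

  coeff-∂zero : ∀ {n} (p : Poly (suc n)) k → coeff (∂ zero p) k ≋ ι (suc k) · coeff p (suc k)
  coeff-∂zero (poly [])       k = ≋-sym (·-0P _)
  coeff-∂zero (poly (a ∷ as)) k = coeffL-derivL 1 as k

  coeffL-mapL∂ : ∀ {n} (j : Fin n) (as : List (Poly n)) k → coeffL (mapL∂ j as) k ≋ ∂ j (coeffL as k)
  coeffL-mapL∂ j []       k       = ≋-sym (∂-0P j)
  coeffL-mapL∂ j (a ∷ as) zero    = ≋-refl
  coeffL-mapL∂ j (a ∷ as) (suc k) = coeffL-mapL∂ j as k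

  coeff-∂suc : ∀ {n} (j : Fin n) (p : Poly (suc n)) k → coeff (∂ (suc j) p) k ≋ ∂ j (coeff p k)
  coeff-∂suc j (poly as) = coeffL-mapL∂ j as

  ∂-cong : ∀ {n} (j : Fin n) {p q : Poly n} → p ≋ q → ∂ j p ≋ ∂ j q
  ∂-cong zero {p} {q} e = coeff-ext λ k → begin
    coeff (∂ zero p) k            ≈⟨ coeff-∂zero p k ⟩
    ι (suc k) · coeff p (suc k)   ≈⟨ ·-congˡ (coeff-cong e (suc k)) ⟩
    ι (suc k) · coeff q (suc k)   ≈⟨ coeff-∂zero q k ⟨
    coeff (∂ zero q) k            ∎
  ∂-cong (suc j) {p} {q} e = coeff-ext λ k → begin
    coeff (∂ (suc j) p) k ≈⟨ coeff-∂suc j p k ⟩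
    ∂ j (coeff p k)       ≈⟨ ∂-cong j (coeff-cong e k) ⟩
    ∂ j (coeff q k)       ≈⟨ coeff-∂suc j q k ⟨
    coeff (∂ (suc j) q) k ∎

  ∂-+P : ∀ {n} (j : Fin n) (p q : Poly n) → ∂ j (p +P q) ≋ ∂ j p +P ∂ j q
  ∂-+P zero p q = coeff-ext λ k → begin
    coeff (∂ zero (p +P q)) k                                  ≈⟨ coeff-∂zero (p +P q) k ⟩
    ι (suc k) · coeff (p +P q) (suc k)                         ≈⟨ ·-congˡ (coeff-+P p q (suc k)) ⟩
    ι (suc k) · (coeff p (suc k) +P coeff q (suc k))           ≈⟨ ·-distribˡ _ _ _ ⟩
    ι (suc k) · coeff p (suc k) +P ι (suc k) · coeff q (suc k) ≈⟨ +P-cong (coeff-∂zero p k) (coeff-∂zero q k) ⟨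
    coeff (∂ zero p) k +P coeff (∂ zero q) k                   ≈⟨ coeff-+P (∂ zero p) (∂ zero q) k ⟨
    coeff (∂ zero p +P ∂ zero q) k                             ∎
  ∂-+P (suc j) p q = coeff-ext λ k → begin
    coeff (∂ (suc j) (p +P q)) k                   ≈⟨ coeff-∂suc j (p +P q) k ⟩
    ∂ j (coeff (p +P q) k)                         ≈⟨ ∂-cong j (coeff-+P p q k) ⟩
    ∂ j (coeff p k +P coeff q k)                   ≈⟨ ∂-+P j _ _ ⟩
    ∂ j (coeff p k) +P ∂ j (coeff q k)             ≈⟨ +P-cong (coeff-∂suc j p k) (coeff-∂suc j q k) ⟨
    coeff (∂ (suc j) p) k +P coeff (∂ (suc j) q) k ≈⟨ coeff-+P (∂ (suc j) p) (∂ (suc j) q) k ⟨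
    coeff (∂ (suc j) p +P ∂ (suc j) q) k           ∎

  ∂-· : ∀ {n} (j : Fin n) a (p : Poly n) → ∂ j (a · p) ≋ a · ∂ j p
  ∂-· zero a p = coeff-ext λ k → begin
    coeff (∂ zero (a · p)) k          ≈⟨ coeff-∂zero (a · p) k ⟩
    ι (suc k) · coeff (a · p) (suc k) ≈⟨ ·-congˡ (coeff-· a p (suc k)) ⟩
    ι (suc k) · a · coeff p (suc k)   ≈⟨ ·-comm _ _ _ ⟩
    a · ι (suc k) · coeff p (suc k)   ≈⟨ ·-congˡ (coeff-∂zero p k) ⟨
    a · coeff (∂ zero p) k            ≈⟨ coeff-· a (∂ zero p) k ⟨
    coeff (a · ∂ zero p) k            ∎
  ∂-· (suc j) a p = coeff-ext λ k → begin
    coeff (∂ (suc j) (a · p)) k ≈⟨ coeff-∂suc j (a · p) k ⟩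
    ∂ j (coeff (a · p) k)       ≈⟨ ∂-cong j (coeff-· a p k) ⟩
    ∂ j (a · coeff p k)         ≈⟨ ∂-· j a _ ⟩
    a · ∂ j (coeff p k)         ≈⟨ ·-congˡ (coeff-∂suc j p k) ⟨
    a · coeff (∂ (suc j) p) k   ≈⟨ coeff-· a (∂ (suc j) p) k ⟨
    coeff (a · ∂ (suc j) p) k   ∎

  ∂zero-∂suc-comm : ∀ {n} (j : Fin n) (p : Poly (suc n)) → ∂ zero (∂ (suc j) p) ≋ ∂ (suc j) (∂ zero p)
  ∂zero-∂suc-comm j p = coeff-ext λ k → begin
    coeff (∂ zero (∂ (suc j) p)) k        ≈⟨ coeff-∂zero (∂ (suc j) p) k ⟩
    ι (suc k) · coeff (∂ (suc j) p) (suc k) ≈⟨ ·-congˡ (coeff-∂suc j p (suc k)) ⟩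
    ι (suc k) · ∂ j (coeff p (suc k))     ≈⟨ ∂-· j _ _ ⟨
    ∂ j (ι (suc k) · coeff p (suc k))     ≈⟨ ∂-cong j (coeff-∂zero p k) ⟨
    ∂ j (coeff (∂ zero p) k)              ≈⟨ coeff-∂suc j (∂ zero p) k ⟨
    coeff (∂ (suc j) (∂ zero p)) k        ∎

  ∂-comm : ∀ {n} (i j : Fin n) (p : Poly n) → ∂ i (∂ j p) ≋ ∂ j (∂ i p)
  ∂-comm zero    zero    p = ≋-refl
  ∂-comm zero    (suc j) p = ∂zero-∂suc-comm j p
  ∂-comm (suc i) zero    p = ≋-sym (∂zero-∂suc-comm i p)
  ∂-comm (suc i) (suc j) p = coeff-ext λ k → begin
    coeff (∂ (suc i) (∂ (suc j) p)) k ≈⟨ coeff-∂suc i (∂ (suc j) p) k ⟩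
    ∂ i (coeff (∂ (suc j) p) k)       ≈⟨ ∂-cong i (coeff-∂suc j p k) ⟩
    ∂ i (∂ j (coeff p k))             ≈⟨ ∂-comm i j _ ⟩
    ∂ j (∂ i (coeff p k))             ≈⟨ ∂-cong j (coeff-∂suc i p k) ⟨
    ∂ j (coeff (∂ (suc i) p) k)       ≈⟨ coeff-∂suc j (∂ (suc i) p) k ⟨
    coeff (∂ (suc j) (∂ (suc i) p)) k ∎

  record Additive {m n} (L : Poly m → Poly n) : Set (c ⊔ ℓ) where
    field
      ⟦⟧-cong : ∀ {p q} → p ≋ q → L p ≋ L q
      0-homo  : L 0P ≋ 0P
      +-homo  : ∀ p q → L (p +P q) ≋ L p +P L q
  open Additive public

  -P-homo : ∀ {m n} {L : Poly m → Poly n} → Additive L → ∀ p → L (-P p) ≋ -P L p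
  -P-homo {L = L} l p = inverseʳ-unique (L p) (L (-P p)) (begin
    L p +P L (-P p) ≈⟨ +-homo l p (-P p) ⟨
    L (p +P -P p)   ≈⟨ ⟦⟧-cong l (+P-inverseʳ p) ⟩
    L 0P            ≈⟨ 0-homo l ⟩
    0P              ∎)

  id-additive : ∀ {n} → Additive {n} (λ p → p)
  id-additive = record { ⟦⟧-cong = λ e → e ; 0-homo = ≋-refl ; +-homo = λ _ _ → ≋-refl }

  ∘-additive : ∀ {m n o} {L : Poly n → Poly o} {L′ : Poly m → Poly n} →
               Additive L → Additive L′ → Additive (L ∘ L′)
  ∘-additive l l′ = record
    { ⟦⟧-cong = ⟦⟧-cong l ∘ ⟦⟧-cong l′
    ; 0-homo  = ≋-trans (⟦⟧-cong l (0-homo l′)) (0-homo l)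
    ; +-homo  = λ p q → ≋-trans (⟦⟧-cong l (+-homo l′ p q)) (+-homo l _ _)
    }

  ^-additive : ∀ {n} {L : Poly n → Poly n} → Additive L → ∀ k → Additive (L ^ k)
  ^-additive l zero    = id-additive
  ^-additive l (suc k) = ∘-additive l (^-additive l k)

  ∂-additive : ∀ {n} (j : Fin n) → Additive (∂ j)
  ∂-additive j = record { ⟦⟧-cong = ∂-cong j ; 0-homo = ∂-0P j ; +-homo = ∂-+P j }

  ·-additive : ∀ {n} a → Additive (_·_ {n} a)
  ·-additive a = record { ⟦⟧-cong = ·-congˡ ; 0-homo = ·-0P a ; +-homo = ·-distribˡ a }

  coeff-additive : ∀ {n} k → Additive (λ (p : Poly (suc n)) → coeff p k)
  coeff-additive k = record { ⟦⟧-cong = λ e → coeff-cong e k ; 0-homo = ≋-refl ; +-homo = λ p q → coeff-+P p q k }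

  sumP-cong : ∀ {n m} {f g : Fin m → Poly n} → (∀ j → f j ≋ g j) → sumP f ≋ sumP g
  sumP-cong {m = zero}  e = ≋-refl
  sumP-cong {m = suc m} e = +P-cong (e zero) (sumP-cong (e ∘ suc))

  sumP-0P : ∀ {n m} {f : Fin m → Poly n} → (∀ j → f j ≋ 0P) → sumP f ≋ 0P
  sumP-0P {m = zero}  e = ≋-refl
  sumP-0P {m = suc m} e = ≋-trans (+P-cong (e zero) (sumP-0P (e ∘ suc))) (+P-identityˡ _)

  sumP-+P : ∀ {n m} (f g : Fin m → Poly n) → sumP (λ j → f j +P g j) ≋ sumP f +P sumP g
  sumP-+P {m = zero}  f g = ≋-sym (+P-identityˡ _)
  sumP-+P {m = suc m} f g =
    ≋-trans (+P-cong ≋-refl (sumP-+P (f ∘ suc) (g ∘ suc))) (interchange _ _ _ _)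

  sumP-homo : ∀ {n n′ m} {L : Poly n → Poly n′} → Additive L → (f : Fin m → Poly n) →
              L (sumP f) ≋ sumP (L ∘ f)
  sumP-homo {m = zero}  l f = 0-homo l
  sumP-homo {m = suc m} l f = ≋-trans (+-homo l _ _) (+P-cong ≋-refl (sumP-homo l (f ∘ suc)))

  sumP-additive : ∀ {n n′ m} (L : Fin m → Poly n → Poly n′) → (∀ j → Additive (L j)) →
                  Additive (λ p → sumP (λ j → L j p))
  sumP-additive L l = record
    { ⟦⟧-cong = λ e → sumP-cong (λ j → ⟦⟧-cong (l j) e)
    ; 0-homo  = sumP-0P (λ j → 0-homo (l j))
    ; +-homo  = λ p q → ≋-trans (sumP-cong (λ j → +-homo (l j) p q)) (sumP-+P (λ j → L j p) (λ j → L j q))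
    }

  ∂[_] : ∀ {n} → (Fin n → K) → Poly n → Poly n
  ∂[ v ] p = sumP (λ j → v j · ∂ j p)

  D≋∂[] : ∀ {n} (M : Fin n → Fin n → K) i p → D M i p ≋ ∂[ M i ] p
  D≋∂[] M i p = sumP-cong (λ j → cst*P≋· (M i j) (∂ j p))

  ∂[]-additive : ∀ {n} (v : Fin n → K) → Additive ∂[ v ]
  ∂[]-additive v = sumP-additive (λ j → (v j ·_) ∘ ∂ j) (λ j → ∘-additive (·-additive (v j)) (∂-additive j))

  ∂[]-· : ∀ {n} (v : Fin n → K) a p → ∂[ v ] (a · p) ≋ a · ∂[ v ] p
  ∂[]-· v a p = begin
    sumP (λ j → v j · ∂ j (a · p)) ≈⟨ sumP-cong (λ j → ≋-trans (·-congˡ (∂-· j a p)) (·-comm _ _ _)) ⟩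
    sumP (λ j → a · v j · ∂ j p)   ≈⟨ sumP-homo (·-additive a) (λ j → v j · ∂ j p) ⟨
    a · ∂[ v ] p                   ∎

  ∂-∂[]-comm : ∀ {n} (i : Fin n) (v : Fin n → K) p → ∂ i (∂[ v ] p) ≋ ∂[ v ] (∂ i p)
  ∂-∂[]-comm i v p = begin
    ∂ i (sumP (λ j → v j · ∂ j p))   ≈⟨ sumP-homo (∂-additive i) (λ j → v j · ∂ j p) ⟩
    sumP (λ j → ∂ i (v j · ∂ j p))   ≈⟨ sumP-cong (λ j → ≋-trans (∂-· i (v j) _) (·-congˡ (∂-comm i j p))) ⟩
    sumP (λ j → v j · ∂ j (∂ i p))   ∎

  ∂[]^-comm : ∀ {n} (v : Fin n → K) k p → (∂[ v ] ^ k) (∂[ v ] p) ≡ ∂[ v ] ((∂[ v ] ^ k) p)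
  ∂[]^-comm v k p = ≡.cong-app (≡.trans (≡.sym (^-homo ∂[ v ] k 1))
                               (≡.trans (≡.cong (∂[ v ] ^_) (ℕ.+-comm k 1)) (^-homo ∂[ v ] 1 k))) p

  coeff-∂[] : ∀ {n} (v : Fin (suc n) → K) p k →
              coeff (∂[ v ] p) k ≋ v zero · ι (suc k) · coeff p (suc k) +P ∂[ v ∘ suc ] (coeff p k)
  coeff-∂[] v p k = begin
    coeff (v zero · ∂ zero p +P sumP (λ j → v (suc j) · ∂ (suc j) p)) k
      ≈⟨ coeff-+P (v zero · ∂ zero p) _ k ⟩
    coeff (v zero · ∂ zero p) k +P coeff (sumP (λ j → v (suc j) · ∂ (suc j) p)) k
      ≈⟨ +P-cong (≋-trans (coeff-· (v zero) (∂ zero p) k) (·-congˡ (coeff-∂zero p k)))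
                 (sumP-homo (coeff-additive k) (λ j → v (suc j) · ∂ (suc j) p)) ⟩
    v zero · ι (suc k) · coeff p (suc k) +P sumP (λ j → coeff (v (suc j) · ∂ (suc j) p) k)
      ≈⟨ +P-cong ≋-refl (sumP-cong (λ j → ≋-trans (coeff-· (v (suc j)) (∂ (suc j) p) k)
                                                  (·-congˡ (coeff-∂suc j p k)))) ⟩
    v zero · ι (suc k) · coeff p (suc k) +P ∂[ v ∘ suc ] (coeff p k) ∎

  embed : ∀ {n} → Poly n → Poly (suc n)
  embed a = poly (a ∷ [])

  x₀*_ : ∀ {n} → Poly (suc n) → Poly (suc n)
  x₀* poly as = poly (0P ∷ as)

  coeff-x₀*-zero : ∀ {n} (p : Poly (suc n)) → coeff (x₀* p) 0 ≋ 0P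
  coeff-x₀*-zero (poly as) = ≋-refl

  coeff-x₀*-suc : ∀ {n} (p : Poly (suc n)) k → coeff (x₀* p) (suc k) ≋ coeff p k
  coeff-x₀*-suc (poly as) k = ≋-refl

  poly-∷≋embed+x₀* : ∀ {n} (a : Poly n) as → poly (a ∷ as) ≋ embed a +P x₀* poly as
  poly-∷≋embed+x₀* a as = coeff-ext λ { zero → ≋-sym (+P-identityʳ a) ; (suc k) → ≋-refl }

  embed-additive : ∀ {n} → Additive (embed {n})
  embed-additive = record
    { ⟦⟧-cong = λ e → coeff-ext λ { zero → e ; (suc k) → ≋-refl }
    ; 0-homo  = coeff-ext coeffL-[0P]
    ; +-homo  = λ p q → coeff-ext λ { zero → ≋-refl ; (suc k) → ≋-refl }
    }

  x₀*-additive : ∀ {n} → Additive (x₀*_ {n})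
  x₀*-additive = record
    { ⟦⟧-cong = λ {p} {q} e → coeff-ext λ
        { zero    → ≋-trans (coeff-x₀*-zero p) (≋-sym (coeff-x₀*-zero q))
        ; (suc k) → ≋-trans (coeff-x₀*-suc p k) (≋-trans (coeff-cong e k) (≋-sym (coeff-x₀*-suc q k))) }
    ; 0-homo  = coeff-ext λ { zero → ≋-refl ; (suc k) → ≋-refl }
    ; +-homo  = λ p q → coeff-ext λ
        { zero    → ≋-trans (coeff-x₀*-zero (p +P q)) (≋-sym (≋-trans (coeff-+P (x₀* p) (x₀* q) 0)
                      (≋-trans (+P-cong (coeff-x₀*-zero p) (coeff-x₀*-zero q)) (+P-identityˡ _))))
        ; (suc k) → ≋-trans (coeff-x₀*-suc (p +P q) k) (≋-trans (coeff-+P p q k)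
                      (≋-sym (≋-trans (coeff-+P (x₀* p) (x₀* q) (suc k))
                                      (+P-cong (coeff-x₀*-suc p k) (coeff-x₀*-suc q k))))) }
    }

  ·-x₀* : ∀ {n} a (p : Poly (suc n)) → a · x₀* p ≋ x₀* (a · p)
  ·-x₀* a p = coeff-ext λ
    { zero    → ≋-trans (coeff-· a (x₀* p) 0) (≋-trans (·-congˡ (coeff-x₀*-zero p))
                  (≋-trans (·-0P a) (≋-sym (coeff-x₀*-zero (a · p)))))
    ; (suc k) → ≋-trans (coeff-· a (x₀* p) (suc k)) (≋-trans (·-congˡ (coeff-x₀*-suc p k))
                  (≋-trans (≋-sym (coeff-· a p k)) (≋-sym (coeff-x₀*-suc (a · p) k)))) }

  ·-·-0P : ∀ {n} a b → a · b · 0P ≋ 0P {n}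
  ·-·-0P a b = ≋-trans (·-congˡ (·-0P b)) (·-0P a)

  ∂[]-embed : ∀ {n} (v : Fin (suc n) → K) a → ∂[ v ] (embed a) ≋ embed (∂[ v ∘ suc ] a)
  ∂[]-embed v a = coeff-ext λ
    { zero    → ≋-trans (coeff-∂[] v (embed a) 0) (≋-trans (+P-cong (·-·-0P _ _) ≋-refl) (+P-identityˡ _))
    ; (suc k) → ≋-trans (coeff-∂[] v (embed a) (suc k))
                  (≋-trans (+P-cong (·-·-0P _ _) (0-homo (∂[]-additive (v ∘ suc)))) (+P-identityˡ _)) }

  ∂[]-x₀* : ∀ {n} (v : Fin (suc n) → K) Q → ∂[ v ] (x₀* Q) ≋ x₀* ∂[ v ] Q +P v zero · Q
  ∂[]-x₀* v Q = coeff-ext λ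
    { zero → begin
        coeff (∂[ v ] (x₀* Q)) 0                           ≈⟨ coeff-∂[] v (x₀* Q) 0 ⟩
        α · ι 1 · coeff (x₀* Q) 1 +P ∂[ v′ ] (coeff (x₀* Q) 0)
          ≈⟨ +P-cong (·-congˡ (≋-trans (·-cong ι1≈1 (coeff-x₀*-suc Q 0)) (·-identityˡ _)))
                     (≋-trans (⟦⟧-cong (∂[]-additive v′) (coeff-x₀*-zero Q)) (0-homo (∂[]-additive v′))) ⟩
        α · coeff Q 0 +P 0P                                ≈⟨ +P-comm _ _ ⟩
        0P +P α · coeff Q 0                                ≈⟨ +P-cong (coeff-x₀*-zero (∂[ v ] Q)) (coeff-· α Q 0) ⟨
        coeff (x₀* ∂[ v ] Q) 0 +P coeff (α · Q) 0          ≈⟨ coeff-+P (x₀* ∂[ v ] Q) (α · Q) 0 ⟨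
        coeff (x₀* ∂[ v ] Q +P α · Q) 0                    ∎
    ; (suc k) → begin
        coeff (∂[ v ] (x₀* Q)) (suc k)                     ≈⟨ coeff-∂[] v (x₀* Q) (suc k) ⟩
        α · ι (suc (suc k)) · coeff (x₀* Q) (suc (suc k)) +P ∂[ v′ ] (coeff (x₀* Q) (suc k))
          ≈⟨ +P-cong (·-congˡ (·-congˡ (coeff-x₀*-suc Q (suc k)))) (⟦⟧-cong (∂[]-additive v′) (coeff-x₀*-suc Q k)) ⟩
        α · (1# + ι (suc k)) · y k +P ∂[ v′ ] (coeff Q k)
          ≈⟨ +P-cong (·-congˡ (≋-trans (·-distribʳ _ _ _) (+P-cong (·-identityˡ _) ≋-refl))) ≋-refl ⟩
        α · (y k +P ι (suc k) · y k) +P ∂[ v′ ] (coeff Q k)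
          ≈⟨ +P-cong (·-distribˡ _ _ _) ≋-refl ⟩
        (α · y k +P α · ι (suc k) · y k) +P ∂[ v′ ] (coeff Q k)
          ≈⟨ +P-assoc _ _ _ ⟩
        α · y k +P (α · ι (suc k) · y k +P ∂[ v′ ] (coeff Q k))
          ≈⟨ +P-comm _ _ ⟩
        (α · ι (suc k) · y k +P ∂[ v′ ] (coeff Q k)) +P α · y k
          ≈⟨ +P-cong (≋-trans (coeff-x₀*-suc (∂[ v ] Q) k) (coeff-∂[] v Q k)) (coeff-· α Q (suc k)) ⟨
        coeff (x₀* ∂[ v ] Q) (suc k) +P coeff (α · Q) (suc k)
          ≈⟨ coeff-+P (x₀* ∂[ v ] Q) (α · Q) (suc k) ⟨
        coeff (x₀* ∂[ v ] Q +P α · Q) (suc k)              ∎ }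
    where
    α  = v zero
    v′ = v ∘ suc
    y  = λ k → coeff Q (suc k)

  ∂[]^-embed : ∀ {n} (v : Fin (suc n) → K) k a → (∂[ v ] ^ k) (embed a) ≋ embed ((∂[ v ∘ suc ] ^ k) a)
  ∂[]^-embed v zero    a = ≋-refl
  ∂[]^-embed v (suc k) a = ≋-trans (⟦⟧-cong (∂[]-additive v) (∂[]^-embed v k a)) (∂[]-embed v _)

  ∂[]^-x₀* : ∀ {n} (v : Fin (suc n) → K) k Q →
             (∂[ v ] ^ suc k) (x₀* Q) ≋ x₀* (∂[ v ] ^ suc k) Q +P (ι (suc k) * v zero) · (∂[ v ] ^ k) Q
  ∂[]^-x₀* v zero Q =
    ≋-trans (∂[]-x₀* v Q) (+P-cong ≋-refl (·-cong (sym (trans (*-cong ι1≈1 refl) (*-identityˡ _))) ≋-refl))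
  ∂[]^-x₀* v (suc k) Q = begin
    ∂[ v ] ((∂[ v ] ^ suc k) (x₀* Q))              ≈⟨ ⟦⟧-cong (∂[]-additive v) (∂[]^-x₀* v k Q) ⟩
    ∂[ v ] (x₀* Y +P (m * α) · Z)                  ≈⟨ +-homo (∂[]-additive v) _ _ ⟩
    ∂[ v ] (x₀* Y) +P ∂[ v ] ((m * α) · Z)         ≈⟨ +P-cong (∂[]-x₀* v Y) (∂[]-· v _ Z) ⟩
    (x₀* ∂[ v ] Y +P α · Y) +P (m * α) · Y         ≈⟨ +P-assoc _ _ _ ⟩
    x₀* ∂[ v ] Y +P (α · Y +P (m * α) · Y)         ≈⟨ +P-cong ≋-refl (·-distribʳ _ _ _) ⟨
    x₀* ∂[ v ] Y +P (α + m * α) · Y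
      ≈⟨ +P-cong ≋-refl (·-cong (sym (trans (distribʳ α 1# m) (+-cong (*-identityˡ α) refl))) ≋-refl) ⟩
    x₀* ∂[ v ] Y +P ((1# + m) * α) · Y             ∎
    where
    α = v zero
    m = ι (suc k)
    Y = (∂[ v ] ^ suc k) Q
    Z = (∂[ v ] ^ k) Q

  -- Degree bounds

  DegreeBelow : ∀ {n} → ℕ → Poly n → Set (c ⊔ ℓ)
  DegreeBelow d       (poly as) = ∀ k → DegreeBelow (d ∸ k) (coeffL as k)
  DegreeBelow zero    (con a)   = Lift c (a ≈ 0#)
  DegreeBelow (suc d) (con a)   = ⊤

  DegreeBelow-coeff : ∀ {n} {d} {p : Poly (suc n)} → DegreeBelow d p → ∀ k → DegreeBelow (d ∸ k) (coeff p k)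
  DegreeBelow-coeff {p = poly as} b = b

  DegreeBelow-by-coeff : ∀ {n} {d} {p : Poly (suc n)} → (∀ k → DegreeBelow (d ∸ k) (coeff p k)) → DegreeBelow d p
  DegreeBelow-by-coeff {p = poly as} b = b

  DegreeBelow-zero⇒≋0P : ∀ {n} {p : Poly n} → DegreeBelow 0 p → p ≋ 0P
  DegreeBelow-zero⇒≋0P {p = con a} b = wrap b
  DegreeBelow-zero⇒≋0P {p = poly as} b = coeff-ext λ k →
    DegreeBelow-zero⇒≋0P (≡.subst (λ d → DegreeBelow d (coeffL as k)) (ℕ.0∸n≡0 k) (b k))

  DegreeBelow-resp : ∀ {n} {d} {p q : Poly n} → p ≋ q → DegreeBelow d p → DegreeBelow d q
  DegreeBelow-resp {d = zero}  {con a} {con b} (wrap (lift e)) (lift z) = lift (trans (sym e) z)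
  DegreeBelow-resp {d = suc d} {con a} {con b} _ _ = tt
  DegreeBelow-resp {p = poly as} {poly bs} e b = λ k → DegreeBelow-resp (coeff-cong e k) (b k)

  DegreeBelow-mono : ∀ {n} {d d′} {p : Poly n} → d ≤ d′ → DegreeBelow d p → DegreeBelow d′ p
  DegreeBelow-mono {d = zero}  {zero}   {con a} _ b = b
  DegreeBelow-mono {d = zero}  {suc d′} {con a} _ _ = tt
  DegreeBelow-mono {d = suc d} {suc d′} {con a} _ _ = tt
  DegreeBelow-mono {p = poly as} d≤d′ b = λ k → DegreeBelow-mono (ℕ.∸-monoˡ-≤ k d≤d′) (b k)

  DegreeBelow-0P : ∀ {n} d → DegreeBelow d (0P {n})
  DegreeBelow-0P {zero}  zero    = lift refl
  DegreeBelow-0P {zero}  (suc d) = tt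
  DegreeBelow-0P {suc n} d       = λ k → DegreeBelow-0P (d ∸ k)

  DegreeBelow-+P : ∀ {n} {d} (p q : Poly n) → DegreeBelow d p → DegreeBelow d q → DegreeBelow d (p +P q)
  DegreeBelow-+P {d = zero}  (con a) (con b) (lift x) (lift y) = lift (trans (+-cong x y) (+-identityʳ 0#))
  DegreeBelow-+P {d = suc d} (con a) (con b) _ _ = tt
  DegreeBelow-+P {suc n} p q bp bq = DegreeBelow-by-coeff λ k →
    DegreeBelow-resp (≋-sym (coeff-+P p q k))
      (DegreeBelow-+P _ _ (DegreeBelow-coeff bp k) (DegreeBelow-coeff bq k))

  DegreeBelow-· : ∀ {n} {d} a (p : Poly n) → DegreeBelow d p → DegreeBelow d (a · p)
  DegreeBelow-· {d = zero}  a (con x) (lift z) = lift (trans (*-cong refl z) (zeroʳ a))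
  DegreeBelow-· {d = suc d} a (con x) _ = tt
  DegreeBelow-· {suc n} a p b = DegreeBelow-by-coeff λ k →
    DegreeBelow-resp (≋-sym (coeff-· a p k)) (DegreeBelow-· a _ (DegreeBelow-coeff b k))

  DegreeBelow-sumP : ∀ {n m} {d} (f : Fin m → Poly n) → (∀ j → DegreeBelow d (f j)) → DegreeBelow d (sumP f)
  DegreeBelow-sumP {m = zero}  f b = DegreeBelow-0P _
  DegreeBelow-sumP {m = suc m} f b = DegreeBelow-+P _ _ (b zero) (DegreeBelow-sumP (f ∘ suc) (b ∘ suc))

  DegreeBelow-∂ : ∀ {n} {d} (j : Fin n) (p : Poly n) → DegreeBelow d p → DegreeBelow (d ∸ 1) (∂ j p)
  DegreeBelow-∂ {suc n} {d} zero p b = DegreeBelow-by-coeff λ k →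
    DegreeBelow-resp (≋-sym (coeff-∂zero p k))
      (DegreeBelow-· _ _ (≡.subst (λ e → DegreeBelow e (coeff p (suc k))) (≡.sym (ℕ.∸-+-assoc d 1 k))
                                 (DegreeBelow-coeff b (suc k))))
  DegreeBelow-∂ {suc n} {d} (suc j) p b = DegreeBelow-by-coeff λ k →
    DegreeBelow-resp (≋-sym (coeff-∂suc j p k))
      (≡.subst (λ e → DegreeBelow e (∂ j (coeff p k))) (d∸k∸1≡d∸1∸k k)
               (DegreeBelow-∂ j (coeff p k) (DegreeBelow-coeff b k)))
    where
    d∸k∸1≡d∸1∸k : ∀ k → d ∸ k ∸ 1 ≡ d ∸ 1 ∸ k
    d∸k∸1≡d∸1∸k k = ≡.trans (ℕ.∸-+-assoc d k 1)
                      (≡.trans (≡.cong (d ∸_) (ℕ.+-comm k 1)) (≡.sym (ℕ.∸-+-assoc d 1 k)))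

  DegreeBelow-∂[] : ∀ {n} {d} (v : Fin n → K) (p : Poly n) → DegreeBelow d p → DegreeBelow (d ∸ 1) (∂[ v ] p)
  DegreeBelow-∂[] v p b = DegreeBelow-sumP _ (λ j → DegreeBelow-· (v j) _ (DegreeBelow-∂ j p b))

  DegreeBelow-∂[]^ : ∀ {n} {d} (v : Fin n → K) k (p : Poly n) → DegreeBelow d p → DegreeBelow d ((∂[ v ] ^ k) p)
  DegreeBelow-∂[]^ v zero    p b = b
  DegreeBelow-∂[]^ v (suc k) p b =
    DegreeBelow-mono (ℕ.m∸n≤m _ 1) (DegreeBelow-∂[] v _ (DegreeBelow-∂[]^ v k p b))

  degreeBound : ∀ {n} (p : Poly n) → ∃ λ d → DegreeBelow d p
  degreeBound (con a)          = 1 , tt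
  degreeBound (poly [])        = 0 , λ k → DegreeBelow-0P _
  degreeBound (poly (a ∷ as)) with degreeBound a | degreeBound (poly as)
  ... | da , ba | d , b = da ℕ.⊔ suc d , λ
    { zero    → DegreeBelow-mono (ℕ.m≤m⊔n da (suc d)) ba
    ; (suc k) → DegreeBelow-mono (ℕ.∸-monoˡ-≤ (suc k) (ℕ.m≤n⊔m da (suc d))) (b k) }

  DegreeBelow-tail : ∀ {n} {d} (a : Poly n) as → DegreeBelow d (poly (a ∷ as)) → DegreeBelow (d ∸ 1) (poly as)
  DegreeBelow-tail {d = d} a as b k = ≡.subst (λ e → DegreeBelow e (coeffL as k)) (≡.sym (ℕ.∸-+-assoc d 1 k)) (b (suc k))

  x≋∂[v]Tx⇒x≋0P : ∀ {n} (v : Fin n → K) (T : Poly n → Poly n) →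
                  (∀ {e} x → DegreeBelow e x → DegreeBelow e (T x)) →
                  ∀ {d} x → DegreeBelow d x → x ≋ ∂[ v ] (T x) → x ≋ 0P
  x≋∂[v]Tx⇒x≋0P v T T-deg {zero}  x b x≋ = DegreeBelow-zero⇒≋0P b
  x≋∂[v]Tx⇒x≋0P v T T-deg {suc d} x b x≋ =
    x≋∂[v]Tx⇒x≋0P v T T-deg {d} x (DegreeBelow-resp (≋-sym x≋) (DegreeBelow-∂[] v (T x) (T-deg x b))) x≋

  ∂-∂[]^-comm : ∀ {n} (i : Fin n) (v : Fin n → K) k p → ∂ i ((∂[ v ] ^ k) p) ≋ (∂[ v ] ^ k) (∂ i p)
  ∂-∂[]^-comm i v zero    p = ≋-refl
  ∂-∂[]^-comm i v (suc k) p = ≋-trans (∂-∂[]-comm i v _) (⟦⟧-cong (∂[]-additive v) (∂-∂[]^-comm i v k p))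

  -- Translations and Taylor's formula

  coeffL-mulL-linear : ∀ {n} β (S : List (Poly n)) k →
                       coeffL (mulL (cst β ∷ cst 1# ∷ []) S) k ≋ β · coeffL S k +P coeffL (0P ∷ S) k
  coeffL-mulL-linear β S k =
    ≋-trans (coeffL-addL (scaleL (cst β) S) _ k) (+P-cong (coeffL-scaleL-cst β S k) (coeffL-x₀*S k))
    where
    coeffL-x₀*S : ∀ k → coeffL (0P ∷ mulL (cst 1# ∷ []) S) k ≋ coeffL (0P ∷ S) k
    coeffL-x₀*S zero    = ≋-refl
    coeffL-x₀*S (suc k) = begin
      coeffL (addL (scaleL (cst 1#) S) (0P ∷ [])) k       ≈⟨ coeffL-addL (scaleL (cst 1#) S) (0P ∷ []) k ⟩
      coeffL (scaleL (cst 1#) S) k +P coeffL (0P ∷ []) k  ≈⟨ +P-cong (coeffL-scaleL-cst 1# S k) (coeffL-[0P] k) ⟩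
      1# · coeffL S k +P 0P                               ≈⟨ +P-identityʳ _ ⟩
      1# · coeffL S k                                     ≈⟨ ·-identityˡ _ ⟩
      coeffL S k                                          ∎

  shift-∷ : ∀ {n} (v : Fin (suc n) → K) a as → let S = poly (shiftL v as) in
            shift v (poly (a ∷ as)) ≋ embed (shift (v ∘ suc) a) +P ((- v zero) · S +P x₀* S)
  shift-∷ v a as = coeff-ext λ k → begin
    coeffL (addL (shift (v ∘ suc) a ∷ []) (mulL (cst (- v zero) ∷ cst 1# ∷ []) (shiftL v as))) k
      ≈⟨ coeffL-addL (shift (v ∘ suc) a ∷ []) (mulL (cst (- v zero) ∷ cst 1# ∷ []) (shiftL v as)) k ⟩
    coeff (embed (shift (v ∘ suc) a)) k +P coeffL (mulL (cst (- v zero) ∷ cst 1# ∷ []) (shiftL v as)) k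
      ≈⟨ +P-cong ≋-refl (coeffL-mulL-linear (- v zero) (shiftL v as) k) ⟩
    coeff (embed (shift (v ∘ suc) a)) k +P ((- v zero) · coeff S k +P coeff (x₀* S) k)
      ≈⟨ +P-cong ≋-refl (+P-cong (coeff-· (- v zero) S k) ≋-refl) ⟨
    coeff (embed (shift (v ∘ suc) a)) k +P (coeff ((- v zero) · S) k +P coeff (x₀* S) k)
      ≈⟨ +P-cong ≋-refl (coeff-+P ((- v zero) · S) (x₀* S) k) ⟨
    coeff (embed (shift (v ∘ suc) a)) k +P coeff ((- v zero) · S +P x₀* S) k
      ≈⟨ coeff-+P (embed (shift (v ∘ suc) a)) ((- v zero) · S +P x₀* S) k ⟨
    coeff (embed (shift (v ∘ suc) a) +P ((- v zero) · S +P x₀* S)) k ∎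
    where S = poly (shiftL v as)

  Δ[_] : ∀ {n} → (Fin n → K) → Poly n → Poly n
  Δ[ v ] p = shift v p +P -P p

  module Taylor (1/[1+_] : ℕ → K) (*-inverse : ∀ k → ι (suc k) * 1/[1+ k ] ≈ 1#) where
    open TaylorCoefficients 1/[1+_] *-inverse

    taylorTerm : ∀ {n} → (Fin n → K) → ℕ → Poly n → Poly n
    taylorTerm v k p = taylorCoeff k · (∂[ v ] ^ k) p

    taylorSum : ∀ {n} → (Fin n → K) → ℕ → Poly n → Poly n
    taylorSum v N p = sumP {m = N} λ k → taylorTerm v (toℕ k) p

    taylorTerm-additive : ∀ {n} (v : Fin n → K) k → Additive (taylorTerm v k)
    taylorTerm-additive v k = ∘-additive (·-additive (taylorCoeff k)) (^-additive (∂[]-additive v) k)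

    taylorSum-additive : ∀ {n} (v : Fin n → K) N → Additive (taylorSum v N)
    taylorSum-additive v N = sumP-additive {m = N} (λ k → taylorTerm v (toℕ k)) (λ k → taylorTerm-additive v (toℕ k))

    taylorSum-embed : ∀ {n} (v : Fin (suc n) → K) N a → taylorSum v N (embed a) ≋ embed (taylorSum (v ∘ suc) N a)
    taylorSum-embed v N a = begin
      sumP (λ (k : Fin N) → taylorCoeff (toℕ k) · (∂[ v ] ^ toℕ k) (embed a))
        ≈⟨ sumP-cong {m = N} (λ k → ·-congˡ (∂[]^-embed v (toℕ k) a)) ⟩
      sumP (λ (k : Fin N) → embed (taylorTerm (v ∘ suc) (toℕ k) a))
        ≈⟨ sumP-homo embed-additive (λ (k : Fin N) → taylorTerm (v ∘ suc) (toℕ k) a) ⟨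
      embed (taylorSum (v ∘ suc) N a) ∎

    taylorTerm-x₀* : ∀ {n} (v : Fin (suc n) → K) k Q →
                     taylorTerm v (suc k) (x₀* Q) ≋ x₀* taylorTerm v (suc k) Q +P (- v zero) · taylorTerm v k Q
    taylorTerm-x₀* v k Q = begin
      t′ · (∂[ v ] ^ suc k) (x₀* Q)
        ≈⟨ ·-congˡ (∂[]^-x₀* v k Q) ⟩
      t′ · (x₀* (∂[ v ] ^ suc k) Q +P (ι (suc k) * α) · (∂[ v ] ^ k) Q)
        ≈⟨ ·-distribˡ _ _ _ ⟩
      t′ · x₀* (∂[ v ] ^ suc k) Q +P t′ · (ι (suc k) * α) · (∂[ v ] ^ k) Q
        ≈⟨ +P-cong (·-x₀* t′ _) (≋-trans (·-assoc _ _ _) (≋-trans (·-cong (taylorCoeff-suc k α) ≋-refl) (≋-sym (·-assoc _ _ _)))) ⟩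
      x₀* taylorTerm v (suc k) Q +P (- α) · taylorTerm v k Q ∎
      where
      α  = v zero
      t′ = taylorCoeff (suc k)

    taylorSum-x₀* : ∀ {n} (v : Fin (suc n) → K) N Q →
                    taylorSum v (suc N) (x₀* Q) ≋ x₀* taylorSum v (suc N) Q +P (- v zero) · taylorSum v N Q
    taylorSum-x₀* v N Q = begin
      1# · x₀* Q +P sumP (λ (k : Fin N) → taylorTerm v (suc (toℕ k)) (x₀* Q))
        ≈⟨ +P-cong (·-x₀* 1# Q) (sumP-cong {m = N} (λ k → taylorTerm-x₀* v (toℕ k) Q)) ⟩
      x₀* (1# · Q) +P sumP (λ (k : Fin N) → x₀* f k +P (- α) · g k)
        ≈⟨ +P-cong ≋-refl (sumP-+P (λ k → x₀* f k) (λ k → (- α) · g k)) ⟩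
      x₀* (1# · Q) +P (sumP (λ k → x₀* f k) +P sumP (λ k → (- α) · g k))
        ≈⟨ +P-cong ≋-refl (+P-cong (sumP-homo x₀*-additive f) (sumP-homo (·-additive (- α)) g)) ⟨
      x₀* (1# · Q) +P (x₀* sumP f +P (- α) · sumP g)
        ≈⟨ +P-assoc _ _ _ ⟨
      (x₀* (1# · Q) +P x₀* sumP f) +P (- α) · sumP g
        ≈⟨ +P-cong (+-homo x₀*-additive _ _) ≋-refl ⟨
      x₀* taylorSum v (suc N) Q +P (- α) · taylorSum v N Q ∎
      where
      α = v zero
      f = λ (k : Fin N) → taylorTerm v (suc (toℕ k)) Q
      g = λ (k : Fin N) → taylorTerm v (toℕ k) Q

    -- Induction along the Horner form: both sides commute with embed and send x₀* Q to
    -- (x₀ - v₀) times their value at Q (shift-∷, taylorSum-x₀*), with N large enough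
    -- for every coefficient by the degree bound.
    shift≋taylorSum : ∀ {n} {d} N (v : Fin n → K) (p : Poly n) → DegreeBelow d p → d ≤ N →
                      shift v p ≋ taylorSum v N p
    shiftL≋taylorSum : ∀ {n} {d} N (v : Fin (suc n) → K) as → DegreeBelow d (poly as) → d ≤ N →
                       poly (shiftL v as) ≋ taylorSum v N (poly as)
    shift≋taylorSum zero    v (con a) b z≤n = wrap b
    shift≋taylorSum (suc N) v (con a) _ _   =
      ≋-sym (≋-trans (+P-cong (·-identityˡ _) (sumP-0P {m = N} (λ _ → ·-0P _))) (+P-identityʳ _))
    shift≋taylorSum N v (poly as) b d≤N = shiftL≋taylorSum N v as b d≤N
    shiftL≋taylorSum N v [] _ _ = ≋-sym (0-homo (taylorSum-additive v N))
    shiftL≋taylorSum zero v (a ∷ as) b z≤n = begin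
      shift v (poly (a ∷ as))                                  ≈⟨ shift-∷ v a as ⟩
      embed (shift (v ∘ suc) a) +P ((- v zero) · S +P x₀* S)
        ≈⟨ +P-cong (⟦⟧-cong embed-additive (shift≋taylorSum 0 (v ∘ suc) a (b 0) z≤n))
                   (+P-cong (·-congˡ S≋0P) (⟦⟧-cong x₀*-additive S≋0P)) ⟩
      embed 0P +P ((- v zero) · 0P +P x₀* 0P)
        ≈⟨ +P-cong (0-homo embed-additive) (+P-cong (·-0P (- v zero)) (0-homo x₀*-additive)) ⟩
      0P +P (0P +P 0P)                                         ≈⟨ +P-identityˡ _ ⟩
      0P +P 0P                                                 ≈⟨ +P-identityˡ _ ⟩
      0P                                                       ∎
      where
      S = poly (shiftL v as)
      S≋0P : S ≋ 0P
      S≋0P = shiftL≋taylorSum 0 v as (DegreeBelow-tail a as b) z≤n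
    shiftL≋taylorSum {d = d} (suc N) v (a ∷ as) b d≤1+N = begin
      shift v (poly (a ∷ as))                                  ≈⟨ shift-∷ v a as ⟩
      embed (shift (v ∘ suc) a) +P ((- v zero) · S +P x₀* S)
        ≈⟨ +P-cong (⟦⟧-cong embed-additive (shift≋taylorSum (suc N) (v ∘ suc) a (b 0) d≤1+N))
                   (+P-cong (·-congˡ (shiftL≋taylorSum N v as bQ (ℕ.∸-monoˡ-≤ 1 d≤1+N)))
                            (⟦⟧-cong x₀*-additive (shiftL≋taylorSum (suc N) v as bQ (ℕ.≤-trans (ℕ.m∸n≤m d 1) d≤1+N)))) ⟩
      embed (taylorSum (v ∘ suc) (suc N) a) +P ((- v zero) · taylorSum v N Q +P x₀* taylorSum v (suc N) Q)
        ≈⟨ +P-cong (taylorSum-embed v (suc N) a) (≋-trans (taylorSum-x₀* v N Q) (+P-comm _ _)) ⟨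
      taylorSum v (suc N) (embed a) +P taylorSum v (suc N) (x₀* Q)
        ≈⟨ +-homo (taylorSum-additive v (suc N)) _ _ ⟨
      taylorSum v (suc N) (embed a +P x₀* Q)
        ≈⟨ ⟦⟧-cong (taylorSum-additive v (suc N)) (poly-∷≋embed+x₀* a as) ⟨
      taylorSum v (suc N) (poly (a ∷ as))                      ∎
      where
      S  = poly (shiftL v as)
      Q  = poly as
      bQ : DegreeBelow (d ∸ 1) Q
      bQ = DegreeBelow-tail a as b

    taylorSum-∂ : ∀ {n} (i : Fin n) (v : Fin n → K) N p → ∂ i (taylorSum v N p) ≋ taylorSum v N (∂ i p)
    taylorSum-∂ i v N p = ≋-trans (sumP-homo (∂-additive i) (λ (k : Fin N) → taylorTerm v (toℕ k) p))
      (sumP-cong {m = N} (λ k → ≋-trans (∂-· i _ _) (·-congˡ (∂-∂[]^-comm i v (toℕ k) p))))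

    ∂-shift : ∀ {n} (i : Fin n) (v : Fin n → K) p → ∂ i (shift v p) ≋ shift v (∂ i p)
    ∂-shift i v p with degreeBound p
    ... | d , b = begin
      ∂ i (shift v p)          ≈⟨ ∂-cong i (shift≋taylorSum d v p b ℕ.≤-refl) ⟩
      ∂ i (taylorSum v d p)    ≈⟨ taylorSum-∂ i v d p ⟩
      taylorSum v d (∂ i p)    ≈⟨ shift≋taylorSum d v (∂ i p) (DegreeBelow-∂ i p b) (ℕ.m∸n≤m d 1) ⟨
      shift v (∂ i p)          ∎

    ∂-Δ[] : ∀ {n} (i : Fin n) (v : Fin n → K) p → ∂ i (Δ[ v ] p) ≋ Δ[ v ] (∂ i p)
    ∂-Δ[] i v p = ≋-trans (∂-+P i _ _) (+P-cong (∂-shift i v p) (-P-homo (∂-additive i) p))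

    taylorTail : ∀ {n} → (Fin n → K) → ℕ → Poly n → Poly n
    taylorTail v d x = sumP {m = d} λ k → taylorCoeff (suc (suc (toℕ k))) · (∂[ v ] ^ toℕ k) x

    DegreeBelow-taylorTail : ∀ {n} {e} (v : Fin n → K) d x → DegreeBelow e x → DegreeBelow e (taylorTail v d x)
    DegreeBelow-taylorTail v d x b = DegreeBelow-sumP {m = d} _ (λ k → DegreeBelow-· _ _ (DegreeBelow-∂[]^ v (toℕ k) x b))

    taylorTail-additive : ∀ {n} (v : Fin n → K) d → Additive (taylorTail v d)
    taylorTail-additive v d = sumP-additive (λ (k : Fin d) → (taylorCoeff (suc (suc (toℕ k))) ·_) ∘ (∂[ v ] ^ toℕ k))
      (λ k → ∘-additive (·-additive _) (^-additive (∂[]-additive v) (toℕ k)))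

    Δ[]-expansion : ∀ {n} {d} (v : Fin n → K) w → DegreeBelow d w →
                    Δ[ v ] w ≋ -P ∂[ v ] w +P ∂[ v ] (taylorTail v d (∂[ v ] w))
    Δ[]-expansion {d = d} v w b = begin
      shift v w +P -P w                                   ≈⟨ +P-cong (shift≋taylorSum (suc (suc d)) v w b d≤2+d) ≋-refl ⟩
      (1# · w +P (taylorCoeff 1 · u +P tail)) +P -P w     ≈⟨ +P-cong (+P-cong (·-identityˡ w) (+P-cong first second)) ≋-refl ⟩
      (w +P (-P u +P ∂[ v ] (taylorTail v d u))) +P -P w  ≈⟨ xyx⁻¹≈y w _ ⟩
      -P u +P ∂[ v ] (taylorTail v d u)                   ∎
      where
      u = ∂[ v ] w
      tail = sumP {m = d} λ k → taylorCoeff (suc (suc (toℕ k))) · ∂[ v ] ((∂[ v ] ^ suc (toℕ k)) w)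
      d≤2+d : d ≤ suc (suc d)
      d≤2+d = ℕ.≤-trans (ℕ.n≤1+n d) (ℕ.n≤1+n (suc d))
      first : taylorCoeff 1 · u ≋ -P u
      first = ≋-trans (·-cong taylorCoeff-1 ≋-refl) (-1·p≋-Pp u)
      second : tail ≋ ∂[ v ] (taylorTail v d u)
      second = ≋-trans
        (sumP-cong {m = d} λ k → ≋-trans (·-congˡ (≋-reflexive (≡.cong ∂[ v ] (≡.sym (∂[]^-comm v (toℕ k) w)))))
                                 (≋-sym (∂[]-· v _ _)))
        (≋-sym (sumP-homo (∂[]-additive v) (λ (k : Fin d) → taylorCoeff (suc (suc (toℕ k))) · (∂[ v ] ^ toℕ k) u)))

    Δ[]≋0P⇔∂[]≋0P : ∀ {n} (v : Fin n → K) w → Δ[ v ] w ≋ 0P ⇔ ∂[ v ] w ≋ 0P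
    Δ[]≋0P⇔∂[]≋0P v w with degreeBound w
    ... | d , b = mk⇔ invariant⇒∂[]≋0P ∂[]≋0P⇒invariant
      where
      u = ∂[ v ] w
      bu : DegreeBelow d u
      bu = DegreeBelow-mono (ℕ.m∸n≤m d 1) (DegreeBelow-∂[] v w b)
      invariant⇒∂[]≋0P : Δ[ v ] w ≋ 0P → u ≋ 0P
      invariant⇒∂[]≋0P Δw≋0P = x≋∂[v]Tx⇒x≋0P v (taylorTail v d) (DegreeBelow-taylorTail v d) u bu
        (≋-trans (≋-sym (⁻¹-involutive u))
                 (≋-sym (inverseʳ-unique (-P u) _ (≋-trans (≋-sym (Δ[]-expansion v w b)) Δw≋0P))))
      ∂[]≋0P⇒invariant : u ≋ 0P → Δ[ v ] w ≋ 0P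
      ∂[]≋0P⇒invariant u≋0P = begin
        Δ[ v ] w                               ≈⟨ Δ[]-expansion v w b ⟩
        -P u +P ∂[ v ] (taylorTail v d u)      ≈⟨ +P-cong (-P-cong u≋0P) (⟦⟧-cong ∂[]∘tail-additive u≋0P) ⟩
        -P 0P +P ∂[ v ] (taylorTail v d 0P)    ≈⟨ +P-cong -P-0P (0-homo ∂[]∘tail-additive) ⟩
        0P +P 0P                               ≈⟨ +P-identityˡ _ ⟩
        0P                                     ∎
        where
        ∂[]∘tail-additive : Additive (∂[ v ] ∘ taylorTail v d)
        ∂[]∘tail-additive = ∘-additive (∂[]-additive v) (taylorTail-additive v d)

module _ {c ℓ} (F : Field c ℓ) (charZero : CharZero F) where
  open Field F using (commutativeRing; inverse)
  open Polynomials commutativeRing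
  open Taylor (λ k → proj₁ (inverse (ι (suc k)) (charZero k))) (λ k → proj₂ (inverse (ι (suc k)) (charZero k)))

  ∂Δ≋0P⇔∂D≋0P : ∀ {n} (M : Fin n → Fin n → Field.Carrier F) p i → ∂ i (Δ M i p) ≋ 0P ⇔ ∂ i (D M i p) ≋ 0P
  ∂Δ≋0P⇔∂D≋0P M p i =
    ⇔.trans (≋⇒≋0P⇔≋0P (∂-Δ[] i (M i) p))
            (⇔.trans (Δ[]≋0P⇔∂[]≋0P (M i) (∂ i p)) (≋⇒≋0P⇔≋0P (≋-sym ∂D≋∂[]∂)))
    where
    ∂D≋∂[]∂ : ∂ i (D M i p) ≋ ∂[ M i ] (∂ i p)
    ∂D≋∂[]∂ = ≋-trans (∂-cong i (D≋∂[] M i p)) (∂-∂[]-comm i (M i) p)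

  InΔ⇔InD : ∀ {n} (M : Fin n → Fin n → Field.Carrier F) p → InΔ M p ⇔ InD M p
  InΔ⇔InD M p = mk⇔ (λ h i → unwrap (to (∂Δ≋0P⇔∂D≋0P M p i) (wrap (h i))))
                    (λ h i → unwrap (from (∂Δ≋0P⇔∂D≋0P M p i) (wrap (h i))))

corollary2p6 : ∀ {c ℓ} (F : Field c ℓ) → CharZero F → (n : ℕ) → 1 ≤ n →
    (M : Fin n → Fin n → Field.Carrier F) →
    (p : PolyOver.Poly (Field.commutativeRing F) n) →
    (PolyOver.InΔ (Field.commutativeRing F) M p → PolyOver.InD (Field.commutativeRing F) M p)
    × (PolyOver.InD (Field.commutativeRing F) M p → PolyOver.InΔ (Field.commutativeRing F) M p)
corollary2p6 F charZero n _ M p = to (InΔ⇔InD F charZero M p) , from (InΔ⇔InD F charZero M p)
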